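{- Let $a\le -1$ be an integer. Define $a_{\mathcal{G}}(n)$, $n\ge0$, by $a_{\mathcal{G}}(0)=1$, $a_{\mathcal{G}}(1)=-1$, $a_{\mathcal{G}}(2)=a$ and, for $n\ge3$, $$a_{\mathcal{G}}(n)=-\frac12\left(\sum_{k=0}^{n-2}a_{\mathcal{G}}(k)\binom{n-1}{k}2^{n-1-k}+\sum_{k=0}^{n-1}a_{\mathcal{G}}(k)\binom{n}{k}2^{n-k}\right).$$ For integers $0\le j\le d$ set $c_{\mathcal{G}}(j,d)=\sum_{k=j}^d2^{ -k}\binom{d-j}{d-k}a_{\mathcal{G}}(k)$. Then for all $m\ge1$: $$0\le c_{\mathcal{G}}(0,4m)\le c_{\mathcal{G}}(1,4m)\le\cdots\le c_{\mathcal{G}}(2m,4m),$$ $$0\le c_{\mathcal{G}}(2m,4m+1)\le c_{\mathcal{G}}(2m-1,4m+1)\le\cdots\le c_{\mathcal{G}}(0,4m+1),$$ $$0\ge c_{\mathcal{G}}(0,4m+2)\ge c_{\mathcal{G}}(1,4m+2)\ge\cdots\ge c_{\mathcal{G}}(2m+1,4m+2),$$ $$0\ge c_{\mathcal{G}}(2m+1,4m+3)\ge c_{\mathcal{G}}(2m,4m+3)\ge\cdots\ge c_{\mathcal{G}}(0,4m+3).$$ -}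

module Defs where

open import Data.Nat as ℕ using (ℕ; zero; suc; _∸_)
open import Data.Nat.Combinatorics using (_C_)
open import Data.Integer as ℤ using (ℤ)
open import Data.Rational using (ℚ; 0ℚ; 1ℚ; ½; -_; _+_; _*_; _/_)
open import Data.List using (List; []; _∷_; _++_; [_])

ℕ→ℚ : ℕ → ℚ
ℕ→ℚ n = ℤ.+ n / 1

half^ : ℕ → ℚ
half^ zero = 1ℚ
half^ (suc k) = ½ * half^ k

two^ : ℕ → ℚ
two^ k = ℕ→ℚ (2 ℕ.^ k)

sumBelow : ℕ → (ℕ → ℚ) → ℚ
sumBelow zero f = 0ℚ
sumBelow (suc n) f = sumBelow n f + f n

-- Σ_{k=lo}^{hi} f k  (empty = 0 when hi < lo)
sumFromTo : ℕ → ℕ → (ℕ → ℚ) → ℚ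
sumFromTo lo hi f = sumBelow (suc hi ∸ lo) (λ i → f (lo ℕ.+ i))

-- lookup with default 0 (only used inside the valid range)
at : List ℚ → ℕ → ℚ
at [] _ = 0ℚ
at (x ∷ xs) zero = x
at (x ∷ xs) (suc n) = at xs n

-- value a_G(n) computed from the list prev = [a_G(0), …, a_G(n-1)]
next : ℤ → ℕ → List ℚ → ℚ
next a 0 prev = 1ℚ
next a 1 prev = - 1ℚ
next a 2 prev = a / 1
next a n@(suc (suc (suc _))) prev =
  - (½ * ( sumFromTo 0 (n ∸ 2) (λ k → at prev k * ℕ→ℚ ((n ∸ 1) C k) * two^ (n ∸ 1 ∸ k))
         + sumFromTo 0 (n ∸ 1) (λ k → at prev k * ℕ→ℚ (n C k) * two^ (n ∸ k))))

aGList : ℤ → ℕ → List ℚ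
aGList a zero = []
aGList a (suc n) = aGList a n ++ [ next a n (aGList a n) ]

aG : ℤ → ℕ → ℚ
aG a n = at (aGList a (suc n)) n

cG : ℤ → ℕ → ℕ → ℚ
cG a j d = sumFromTo j d (λ k → half^ k * ℕ→ℚ ((d ∸ j) C (d ∸ k)) * aG a k)

-- Put b(k) = 2^{-k} a_G(k). Then c_G(j, j+n) = Σ_i (n choose i) b(j+i), which gives Pascal's rule
-- c(j, d+1) = c(j, d) + c(j+1, d+1), and the recurrence for a_G becomes b(n) + c(0,n) = ½ (b(n-1) - c(0,n-1))
-- for n ≥ 3. If row d is symmetric, Pascal's rule makes c(i,d+1) - (-1)^(d+1) c(d+1-i,d+1) independent of i,
-- and it vanishes at i = 0 (automatically for even d+1, by the recurrence for odd d+1); so every row satisfies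
-- c(i,d) = (-1)^d c(d-i,d). Symmetry gives c(h,2h+1) = ½ c(h,2h) in the middle of an odd row and, together with
-- the recurrence, c(0,2h+2) = -½ c(0,2h+1) at the start of an even row. Since c(j+1,d+1) = c(j,d+1) - c(j,d),
-- a row of constant sign on its first half is followed by a row that is monotone there, and these two formulas
-- fix the sign of the entry that bounds it; the four patterns thus propagate row by row from row 2,
-- where c(0,2) = a/4 ≤ 0.

module Submission where

open import Defs

-- ℚ arithmetic is opened only in this block: after it, _+_ and _*_ are those of ℕ, as in the statement.
module _ where
  open import Function.Base using (flip)
  open import Data.Nat as ℕ using (ℕ; zero; suc; _∸_; z≤n; s≤s)
  import Data.Nat.Properties as ℕP
  open import Data.Nat.Combinatorics using (_C_; nCn≡1; k>n⇒nCk≡0; nCk+nC[k+1]≡[n+1]C[k+1]; nCk≡nC[n∸k])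
  open import Data.Integer as ℤ using (ℤ; -[1+_])
  import Data.Integer.Properties as ℤP
  open import Data.Rational hiding (truncate)
  open import Data.Rational.Properties
  open import Data.Rational.Unnormalised as ℚᵘ using (mkℚᵘ; *≡*)
  import Data.Rational.Unnormalised.Properties as ℚᵘP
  open import Data.Rational.Solver using (module +-*-Solver)
  open import Algebra.Properties.Group +-0-group using (⁻¹-involutive; x∙y⁻¹≈ε⇒x≈y; x≈y⇒x∙y⁻¹≈ε)
  open import Data.List using (List; []; _∷_; _++_; [_]; length)
  open import Data.List.Properties using (length-++)
  open import Data.Product using (_×_; _,_)
  open import Data.Sum using (_⊎_; inj₁; inj₂)
  open import Relation.Binary.Core using (Rel)
  open import Relation.Binary.Definitions using (Reflexive; Transitive)
  open import Relation.Binary.PropositionalEquality hiding ([_])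
  open +-*-Solver

  toℚᵘ-ℕ→ℚ : ∀ n → toℚᵘ (ℕ→ℚ n) ℚᵘ.≃ mkℚᵘ (ℤ.+ n) 0
  toℚᵘ-ℕ→ℚ n = toℚᵘ-fromℚᵘ (mkℚᵘ (ℤ.+ n) 0)

  ℕ→ℚ-+ : ∀ m n → ℕ→ℚ (m ℕ.+ n) ≡ ℕ→ℚ m + ℕ→ℚ n
  ℕ→ℚ-+ m n = toℚᵘ-injective (begin
    toℚᵘ (ℕ→ℚ (m ℕ.+ n))              ≈⟨ toℚᵘ-ℕ→ℚ (m ℕ.+ n) ⟩
    mkℚᵘ (ℤ.+ (m ℕ.+ n)) 0            ≈⟨ *≡* (cong (ℤ._* ℤ.+ 1) (sym (cong₂ ℤ._+_ (ℤP.*-identityʳ (ℤ.+ m))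
                                                                                      (ℤP.*-identityʳ (ℤ.+ n))))) ⟩
    mkℚᵘ (ℤ.+ m) 0 ℚᵘ.+ mkℚᵘ (ℤ.+ n) 0  ≈⟨ ℚᵘP.+-cong (toℚᵘ-ℕ→ℚ m) (toℚᵘ-ℕ→ℚ n) ⟨
    toℚᵘ (ℕ→ℚ m) ℚᵘ.+ toℚᵘ (ℕ→ℚ n)    ≈⟨ toℚᵘ-homo-+ (ℕ→ℚ m) (ℕ→ℚ n) ⟨
    toℚᵘ (ℕ→ℚ m + ℕ→ℚ n)              ∎)
    where open ℚᵘP.≃-Reasoning

  ℕ→ℚ-* : ∀ m n → ℕ→ℚ (m ℕ.* n) ≡ ℕ→ℚ m * ℕ→ℚ n
  ℕ→ℚ-* m n = toℚᵘ-injective (begin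
    toℚᵘ (ℕ→ℚ (m ℕ.* n))              ≈⟨ toℚᵘ-ℕ→ℚ (m ℕ.* n) ⟩
    mkℚᵘ (ℤ.+ (m ℕ.* n)) 0            ≈⟨ *≡* (cong (ℤ._* ℤ.+ 1) (ℤP.pos-* m n)) ⟩
    mkℚᵘ (ℤ.+ m) 0 ℚᵘ.* mkℚᵘ (ℤ.+ n) 0  ≈⟨ ℚᵘP.*-cong (toℚᵘ-ℕ→ℚ m) (toℚᵘ-ℕ→ℚ n) ⟨
    toℚᵘ (ℕ→ℚ m) ℚᵘ.* toℚᵘ (ℕ→ℚ n)    ≈⟨ toℚᵘ-homo-* (ℕ→ℚ m) (ℕ→ℚ n) ⟨
    toℚᵘ (ℕ→ℚ m * ℕ→ℚ n)              ∎)
    where open ℚᵘP.≃-Reasoning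

  two^-suc : ∀ k → two^ (suc k) ≡ ℕ→ℚ 2 * two^ k
  two^-suc k = ℕ→ℚ-* 2 (2 ℕ.^ k)

  two^-+ : ∀ m n → two^ (m ℕ.+ n) ≡ two^ m * two^ n
  two^-+ m n = trans (cong ℕ→ℚ (ℕP.^-distribˡ-+-* 2 m n)) (ℕ→ℚ-* (2 ℕ.^ m) (2 ℕ.^ n))

  two^*half^ : ∀ k → two^ k * half^ k ≡ 1ℚ
  two^*half^ zero = refl
  two^*half^ (suc k) = begin
    two^ (suc k) * (½ * half^ k)         ≡⟨ cong (_* (½ * half^ k)) (two^-suc k) ⟩
    (ℕ→ℚ 2 * two^ k) * (½ * half^ k)     ≡⟨ solve 2 (λ t h → (con (ℕ→ℚ 2) :* t) :* (con ½ :* h) := t :* h)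
                                                    refl (two^ k) (half^ k) ⟩
    two^ k * half^ k                      ≡⟨ two^*half^ k ⟩
    1ℚ                                    ∎
    where open ≡-Reasoning

  two^-∸ : ∀ {k q} → k ℕ.≤ q → two^ (q ∸ k) ≡ two^ q * half^ k
  two^-∸ {k} {q} k≤q = begin
    two^ (q ∸ k)                        ≡⟨ *-identityʳ (two^ (q ∸ k)) ⟨
    two^ (q ∸ k) * 1ℚ                   ≡⟨ cong (two^ (q ∸ k) *_) (two^*half^ k) ⟨
    two^ (q ∸ k) * (two^ k * half^ k)   ≡⟨ *-assoc (two^ (q ∸ k)) (two^ k) (half^ k) ⟨
    two^ (q ∸ k) * two^ k * half^ k     ≡⟨ cong (_* half^ k) (two^-+ (q ∸ k) k) ⟨
    two^ (q ∸ k ℕ.+ k) * half^ k        ≡⟨ cong (λ e → two^ e * half^ k) (ℕP.m∸n+n≡m k≤q) ⟩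
    two^ q * half^ k                    ∎
    where open ≡-Reasoning

  sumBelow-cong : ∀ n {f g : ℕ → ℚ} → (∀ i → i ℕ.< n → f i ≡ g i) → sumBelow n f ≡ sumBelow n g
  sumBelow-cong zero f≗g = refl
  sumBelow-cong (suc n) f≗g =
    cong₂ _+_ (sumBelow-cong n (λ i i<n → f≗g i (ℕP.m<n⇒m<1+n i<n))) (f≗g n ℕP.≤-refl)

  sumBelow-+ : ∀ n (f g : ℕ → ℚ) → sumBelow n (λ i → f i + g i) ≡ sumBelow n f + sumBelow n g
  sumBelow-+ zero f g = refl
  sumBelow-+ (suc n) f g = trans (cong (_+ (f n + g n)) (sumBelow-+ n f g))
    (solve 4 (λ s t x y → (s :+ t) :+ (x :+ y) := (s :+ x) :+ (t :+ y))
             refl (sumBelow n f) (sumBelow n g) (f n) (g n))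

  *-distribˡ-sumBelow : ∀ c n (f : ℕ → ℚ) → c * sumBelow n f ≡ sumBelow n (λ i → c * f i)
  *-distribˡ-sumBelow c zero f = *-zeroʳ c
  *-distribˡ-sumBelow c (suc n) f =
    trans (*-distribˡ-+ c (sumBelow n f) (f n)) (cong (_+ c * f n) (*-distribˡ-sumBelow c n f))

  sumBelow-unshift : ∀ n (f : ℕ → ℚ) → sumBelow (suc n) f ≡ f 0 + sumBelow n (λ i → f (suc i))
  sumBelow-unshift zero f = trans (+-identityˡ (f 0)) (sym (+-identityʳ (f 0)))
  sumBelow-unshift (suc n) f = trans (cong (_+ f (suc n)) (sumBelow-unshift n f)) (+-assoc (f 0) _ _)

  at-++ˡ : ∀ (xs ys : List ℚ) {k} → k ℕ.< length xs → at (xs ++ ys) k ≡ at xs k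
  at-++ˡ (x ∷ xs) ys {zero} _ = refl
  at-++ˡ (x ∷ xs) ys {suc k} (s≤s k<) = at-++ˡ xs ys k<

  at-++-length : ∀ (xs : List ℚ) y → at (xs ++ [ y ]) (length xs) ≡ y
  at-++-length [] y = refl
  at-++-length (x ∷ xs) y = at-++-length xs y

  length-aGList : ∀ a n → length (aGList a n) ≡ n
  length-aGList a zero = refl
  length-aGList a (suc n) = trans (length-++ (aGList a n)) (trans (ℕP.+-comm _ 1) (cong suc (length-aGList a n)))

  aG-unfold : ∀ a n → aG a n ≡ next a n (aGList a n)
  aG-unfold a n = subst (λ k → at (aGList a n ++ [ next a n (aGList a n) ]) k ≡ next a n (aGList a n))
    (length-aGList a n) (at-++-length (aGList a n) _)

  at-aGList : ∀ a {n k} → k ℕ.< n → at (aGList a n) k ≡ aG a k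
  at-aGList a {suc n} {k} k<1+n with ℕP.m≤n⇒m<n∨m≡n (ℕP.≤-pred k<1+n)
  ... | inj₁ k<n = trans (at-++ˡ (aGList a n) _ (subst (k ℕ.<_) (sym (length-aGList a n)) k<n)) (at-aGList a k<n)
  ... | inj₂ refl = refl

  b : ℤ → ℕ → ℚ
  b a k = half^ k * aG a k

  binomialTransform : ℤ → ℕ → ℕ → ℚ
  binomialTransform a j n = sumBelow (suc n) (λ i → ℕ→ℚ (n C i) * b a (j ℕ.+ i))

  cG≡binomialTransform : ∀ a j n → cG a j (j ℕ.+ n) ≡ binomialTransform a j n
  cG≡binomialTransform a j n rewrite sym (ℕP.+-suc j n) | ℕP.m+n∸m≡n j (suc n) | ℕP.m+n∸m≡n j n =
    sumBelow-cong (suc n) termwise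
    where
    termwise : ∀ i → i ℕ.< suc n →
      half^ (j ℕ.+ i) * ℕ→ℚ (n C (j ℕ.+ n ∸ (j ℕ.+ i))) * aG a (j ℕ.+ i) ≡ ℕ→ℚ (n C i) * b a (j ℕ.+ i)
    termwise i i≤n rewrite ℕP.[m+n]∸[m+o]≡n∸o j n i | sym (nCk≡nC[n∸k] (ℕP.≤-pred i≤n)) =
      solve 3 (λ h c x → h :* c :* x := c :* (h :* x)) refl
              (half^ (j ℕ.+ i)) (ℕ→ℚ (n C i)) (aG a (j ℕ.+ i))

  binomialTransform-pascal : ∀ a j n →
    binomialTransform a j (suc n) ≡ binomialTransform a j n + binomialTransform a (suc j) n
  binomialTransform-pascal a j n = begin
    binomialTransform a j (suc n)
      ≡⟨ sumBelow-unshift (suc n) _ ⟩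
    x₀ + sumBelow (suc n) (λ i → ℕ→ℚ (suc n C suc i) * b a (j ℕ.+ suc i))
      ≡⟨ cong (x₀ +_) (sumBelow-cong (suc n) (λ i _ → pascal i)) ⟩
    x₀ + sumBelow (suc n) (λ i → ℕ→ℚ (n C i) * b a (suc j ℕ.+ i) + ℕ→ℚ (n C suc i) * b a (j ℕ.+ suc i))
      ≡⟨ cong (x₀ +_) (sumBelow-+ (suc n) _ _) ⟩
    x₀ + (binomialTransform a (suc j) n + (S + ℕ→ℚ (n C suc n) * b a (j ℕ.+ suc n)))
      ≡⟨ cong (λ c → x₀ + (binomialTransform a (suc j) n + (S + ℕ→ℚ c * b a (j ℕ.+ suc n))))
              (k>n⇒nCk≡0 (ℕP.n<1+n n)) ⟩
    x₀ + (binomialTransform a (suc j) n + (S + 0ℚ * b a (j ℕ.+ suc n)))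
      ≡⟨ solve 4 (λ x t s y → x :+ (t :+ (s :+ con 0ℚ :* y)) := (x :+ s) :+ t)
                 refl x₀ (binomialTransform a (suc j) n) S (b a (j ℕ.+ suc n)) ⟩
    (x₀ + S) + binomialTransform a (suc j) n
      ≡⟨ cong (_+ binomialTransform a (suc j) n) (sumBelow-unshift n _) ⟨
    binomialTransform a j n + binomialTransform a (suc j) n ∎
    where
    open ≡-Reasoning
    x₀ = ℕ→ℚ 1 * b a (j ℕ.+ 0)
    S = sumBelow n (λ i → ℕ→ℚ (n C suc i) * b a (j ℕ.+ suc i))
    pascal : ∀ i → ℕ→ℚ (suc n C suc i) * b a (j ℕ.+ suc i)
                 ≡ ℕ→ℚ (n C i) * b a (suc j ℕ.+ i) + ℕ→ℚ (n C suc i) * b a (j ℕ.+ suc i)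
    pascal i = begin
      ℕ→ℚ (suc n C suc i) * b a (j ℕ.+ suc i)
        ≡⟨ cong (λ c → ℕ→ℚ c * b a (j ℕ.+ suc i)) (nCk+nC[k+1]≡[n+1]C[k+1] n i) ⟨
      ℕ→ℚ (n C i ℕ.+ n C suc i) * b a (j ℕ.+ suc i)
        ≡⟨ cong (_* b a (j ℕ.+ suc i)) (ℕ→ℚ-+ (n C i) (n C suc i)) ⟩
      (ℕ→ℚ (n C i) + ℕ→ℚ (n C suc i)) * b a (j ℕ.+ suc i)
        ≡⟨ *-distribʳ-+ (b a (j ℕ.+ suc i)) (ℕ→ℚ (n C i)) (ℕ→ℚ (n C suc i)) ⟩
      ℕ→ℚ (n C i) * b a (j ℕ.+ suc i) + ℕ→ℚ (n C suc i) * b a (j ℕ.+ suc i)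
        ≡⟨ cong (λ e → ℕ→ℚ (n C i) * b a e + ℕ→ℚ (n C suc i) * b a (j ℕ.+ suc i)) (ℕP.+-suc j i) ⟩
      ℕ→ℚ (n C i) * b a (suc j ℕ.+ i) + ℕ→ℚ (n C suc i) * b a (j ℕ.+ suc i) ∎

  cG-pascal : ∀ a {d j} → j ℕ.≤ d → cG a j (suc d) ≡ cG a j d + cG a (suc j) (suc d)
  cG-pascal a {d} {j} j≤d =
    subst (λ d → cG a j (suc d) ≡ cG a j d + cG a (suc j) (suc d)) (ℕP.m+[n∸m]≡n j≤d) (begin
      cG a j (suc (j ℕ.+ n))                                   ≡⟨ cong (cG a j) (ℕP.+-suc j n) ⟨
      cG a j (j ℕ.+ suc n)                                     ≡⟨ cG≡binomialTransform a j (suc n) ⟩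
      binomialTransform a j (suc n)                            ≡⟨ binomialTransform-pascal a j n ⟩
      binomialTransform a j n + binomialTransform a (suc j) n  ≡⟨ cong₂ _+_ (cG≡binomialTransform a j n)
                                                                            (cG≡binomialTransform a (suc j) n) ⟨
      cG a j (j ℕ.+ n) + cG a (suc j) (suc (j ℕ.+ n))          ∎)
    where
    open ≡-Reasoning
    n = d ∸ j

  cG-suc-index : ∀ a {d j} → j ℕ.≤ d → cG a (suc j) (suc d) ≡ cG a j (suc d) - cG a j d
  cG-suc-index a {d} {j} j≤d = begin
    cG a (suc j) (suc d)                         ≡⟨ solve 2 (λ x y → x := (y :+ x) :- y) refl _ (cG a j d) ⟩
    (cG a j d + cG a (suc j) (suc d)) - cG a j d ≡⟨ cong (_- cG a j d) (cG-pascal a j≤d) ⟨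
    cG a j (suc d) - cG a j d                   ∎
    where open ≡-Reasoning

  cG-diagonal : ∀ a d → cG a d d ≡ b a d
  cG-diagonal a d = begin
    cG a d d                   ≡⟨ cong (cG a d) (ℕP.+-identityʳ d) ⟨
    cG a d (d ℕ.+ 0)           ≡⟨ cG≡binomialTransform a d 0 ⟩
    0ℚ + 1ℚ * b a (d ℕ.+ 0)    ≡⟨ trans (+-identityˡ _) (*-identityˡ _) ⟩
    b a (d ℕ.+ 0)              ≡⟨ cong (b a) (ℕP.+-identityʳ d) ⟩
    b a d                      ∎
    where open ≡-Reasoning

  recurrenceSum : ∀ a {n} q → q ℕ.≤ n →
    sumBelow q (λ k → at (aGList a n) k * ℕ→ℚ (q C k) * two^ (q ∸ k)) ≡ two^ q * (cG a 0 q - b a q)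
  recurrenceSum a {n} q q≤n = begin
    sumBelow q (λ k → at (aGList a n) k * ℕ→ℚ (q C k) * two^ (q ∸ k))
      ≡⟨ sumBelow-cong q termwise ⟩
    sumBelow q (λ k → two^ q * (ℕ→ℚ (q C k) * b a k))
      ≡⟨ *-distribˡ-sumBelow (two^ q) q _ ⟨
    two^ q * S
      ≡⟨ cong (two^ q *_) (solve 2 (λ s x → s := (s :+ con 1ℚ :* x) :- x) refl S (b a q)) ⟩
    two^ q * ((S + 1ℚ * b a q) - b a q)
      ≡⟨ cong (λ c → two^ q * ((S + ℕ→ℚ c * b a q) - b a q)) (nCn≡1 q) ⟨
    two^ q * (binomialTransform a 0 q - b a q)
      ≡⟨ cong (λ c → two^ q * (c - b a q)) (cG≡binomialTransform a 0 q) ⟨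
    two^ q * (cG a 0 q - b a q) ∎
    where
    open ≡-Reasoning
    S = sumBelow q (λ k → ℕ→ℚ (q C k) * b a k)
    termwise : ∀ k → k ℕ.< q →
      at (aGList a n) k * ℕ→ℚ (q C k) * two^ (q ∸ k) ≡ two^ q * (ℕ→ℚ (q C k) * b a k)
    termwise k k<q = begin
      at (aGList a n) k * ℕ→ℚ (q C k) * two^ (q ∸ k)
        ≡⟨ cong₂ (λ x t → x * ℕ→ℚ (q C k) * t) (at-aGList a (ℕP.<-≤-trans k<q q≤n))
                                                (two^-∸ (ℕP.<⇒≤ k<q)) ⟩
      aG a k * ℕ→ℚ (q C k) * (two^ q * half^ k)
        ≡⟨ solve 4 (λ x c t h → x :* c :* (t :* h) := t :* (c :* (h :* x)))
                   refl (aG a k) (ℕ→ℚ (q C k)) (two^ q) (half^ k) ⟩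
      two^ q * (ℕ→ℚ (q C k) * b a k) ∎

  aG-recurrence : ∀ a p → aG a (3 ℕ.+ p) ≡
    - (½ * (two^ (2 ℕ.+ p) * (cG a 0 (2 ℕ.+ p) - b a (2 ℕ.+ p))
            + two^ (3 ℕ.+ p) * (cG a 0 (3 ℕ.+ p) - b a (3 ℕ.+ p))))
  aG-recurrence a p = trans (aG-unfold a (3 ℕ.+ p))
    (cong₂ (λ u v → - (½ * (u + v))) (recurrenceSum a (2 ℕ.+ p) (ℕP.n≤1+n _))
                                     (recurrenceSum a (3 ℕ.+ p) ℕP.≤-refl))

  cG-recurrence : ∀ a p → b a (3 ℕ.+ p) + cG a 0 (3 ℕ.+ p) ≡ ½ * (b a (2 ℕ.+ p) - cG a 0 (2 ℕ.+ p))
  cG-recurrence a p = x∙y⁻¹≈ε⇒x≈y (x + f) (½ * (y - g)) (begin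
    (x + f) - ½ * (y - g)                             ≡⟨ solve 4 (λ x f y g →
                                                           (x :+ f) :- con ½ :* (y :- g)
                                                           := con (ℕ→ℚ 2)
                                                              :* (x :- (:- (con ½ :* (con ½ :* (g :- y) :+ con 1ℚ :* (f :- x))))))
                                                         refl x f y g ⟩
    ℕ→ℚ 2 * (x - - (½ * (½ * (g - y) + 1ℚ * (f - x)))) ≡⟨ cong (λ z → ℕ→ℚ 2 * (x - z)) scaledRecurrence ⟨
    ℕ→ℚ 2 * (x - x)                                   ≡⟨ cong (ℕ→ℚ 2 *_) (+-inverseʳ x) ⟩
    ℕ→ℚ 2 * 0ℚ                                        ≡⟨ *-zeroʳ (ℕ→ℚ 2) ⟩
    0ℚ                                                ∎)
    where
    open ≡-Reasoning
    q = 2 ℕ.+ p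
    n = 3 ℕ.+ p
    x = b a n
    f = cG a 0 n
    y = b a q
    g = cG a 0 q
    half^n*two^q : half^ n * two^ q ≡ ½
    half^n*two^q = begin
      (½ * half^ q) * two^ q  ≡⟨ *-assoc ½ (half^ q) (two^ q) ⟩
      ½ * (half^ q * two^ q)  ≡⟨ cong (½ *_) (trans (*-comm (half^ q) (two^ q)) (two^*half^ q)) ⟩
      ½ * 1ℚ                  ≡⟨ *-identityʳ ½ ⟩
      ½                       ∎
    half^n*two^n : half^ n * two^ n ≡ 1ℚ
    half^n*two^n = trans (*-comm (half^ n) (two^ n)) (two^*half^ n)
    scaledRecurrence : x ≡ - (½ * (½ * (g - y) + 1ℚ * (f - x)))
    scaledRecurrence = begin
      half^ n * aG a n
        ≡⟨ cong (half^ n *_) (aG-recurrence a p) ⟩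
      half^ n * - (½ * (two^ q * (g - y) + two^ n * (f - x)))
        ≡⟨ solve 5 (λ h t t′ u v → h :* (:- (con ½ :* (t :* u :+ t′ :* v)))
                                   := :- (con ½ :* ((h :* t) :* u :+ (h :* t′) :* v)))
                   refl (half^ n) (two^ q) (two^ n) (g - y) (f - x) ⟩
      - (½ * ((half^ n * two^ q) * (g - y) + (half^ n * two^ n) * (f - x)))
        ≡⟨ cong₂ (λ u v → - (½ * (u * (g - y) + v * (f - x)))) half^n*two^q half^n*two^n ⟩
      - (½ * (½ * (g - y) + 1ℚ * (f - x))) ∎

  minusOne^ : ℕ → ℚ
  minusOne^ zero = 1ℚ
  minusOne^ (suc d) = - minusOne^ d

  minusOne^-cases : ∀ d → minusOne^ d ≡ 1ℚ ⊎ minusOne^ d ≡ - 1ℚ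
  minusOne^-cases zero = inj₁ refl
  minusOne^-cases (suc d) with minusOne^-cases d
  ... | inj₁ even = inj₂ (cong -_ even)
  ... | inj₂ odd = inj₁ (cong -_ odd)

  minusOne^-double : ∀ h → minusOne^ (h ℕ.+ h) ≡ 1ℚ
  minusOne^-double zero = refl
  minusOne^-double (suc h) = begin
    - minusOne^ (h ℕ.+ suc h)    ≡⟨ cong (λ e → - minusOne^ e) (ℕP.+-suc h h) ⟩
    - - minusOne^ (h ℕ.+ h)      ≡⟨ ⁻¹-involutive _ ⟩
    minusOne^ (h ℕ.+ h)          ≡⟨ minusOne^-double h ⟩
    1ℚ                           ∎
    where open ≡-Reasoning

  Symmetric : ℤ → ℕ → Set
  Symmetric a d = ∀ i j → i ℕ.+ j ≡ d → cG a i d ≡ minusOne^ d * cG a j d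

  cG-symmetric-zero : ∀ a → Symmetric a 0
  cG-symmetric-zero a zero zero refl = sym (*-identityˡ _)

  cG-zero≡b : ∀ a {d} → Symmetric a d → minusOne^ d ≡ 1ℚ → cG a 0 d ≡ b a d
  cG-zero≡b a {d} sym-d even = trans (sym-d 0 d refl) (trans (cong₂ _*_ even (cG-diagonal a d)) (*-identityˡ _))

  b≡-cG-zero : ∀ a {d} → Symmetric a d → minusOne^ d ≡ - 1ℚ → b a d ≡ - cG a 0 d
  b≡-cG-zero a {d} sym-d odd = begin
    b a d                           ≡⟨ solve 1 (λ x → x := :- (con (- 1ℚ) :* x)) refl (b a d) ⟩
    - (- 1ℚ * b a d)                ≡⟨ cong -_ (cong₂ _*_ odd (cG-diagonal a d)) ⟨
    - (minusOne^ d * cG a d d)      ≡⟨ cong -_ (sym-d 0 d refl) ⟨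
    - cG a 0 d                      ∎
    where open ≡-Reasoning

  antidiagonal-invariant : ∀ a d → Symmetric a d → ∀ i j → i ℕ.+ j ≡ suc d →
    cG a i (suc d) - minusOne^ (suc d) * cG a j (suc d) ≡ cG a 0 (suc d) - minusOne^ (suc d) * cG a (suc d) (suc d)
  antidiagonal-invariant a d sym-d zero j refl = refl
  antidiagonal-invariant a d sym-d (suc i) j 1+i+j≡1+d =
    trans shift (antidiagonal-invariant a d sym-d i (suc j) (trans (ℕP.+-suc i j) 1+i+j≡1+d))
    where
    open ≡-Reasoning
    i+j≡d : i ℕ.+ j ≡ d
    i+j≡d = ℕP.suc-injective 1+i+j≡1+d
    i≤d = subst (i ℕ.≤_) i+j≡d (ℕP.m≤m+n i j)
    j≤d = subst (j ℕ.≤_) i+j≡d (ℕP.m≤n+m j i)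
    t = minusOne^ d
    shift : cG a (suc i) (suc d) - (- t) * cG a j (suc d) ≡ cG a i (suc d) - (- t) * cG a (suc j) (suc d)
    shift = begin
      cG a (suc i) (suc d) - (- t) * cG a j (suc d)
        ≡⟨ cong (λ z → cG a (suc i) (suc d) - (- t) * z) (cG-pascal a j≤d) ⟩
      cG a (suc i) (suc d) - (- t) * (cG a j d + cG a (suc j) (suc d))
        ≡⟨ solve 4 (λ t x y z → x :- (:- t) :* (y :+ z) := (t :* y :+ x) :- (:- t) :* z)
                   refl t (cG a (suc i) (suc d)) (cG a j d) (cG a (suc j) (suc d)) ⟩
      (t * cG a j d + cG a (suc i) (suc d)) - (- t) * cG a (suc j) (suc d)
        ≡⟨ cong (λ z → z - (- t) * cG a (suc j) (suc d)) (cong (_+ cG a (suc i) (suc d)) (sym-d i j i+j≡d)) ⟨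
      (cG a i d + cG a (suc i) (suc d)) - (- t) * cG a (suc j) (suc d)
        ≡⟨ cong (λ z → z - (- t) * cG a (suc j) (suc d)) (cG-pascal a i≤d) ⟨
      cG a i (suc d) - (- t) * cG a (suc j) (suc d) ∎

  cG-symmetric-suc : ∀ a d → Symmetric a d →
    cG a 0 (suc d) ≡ minusOne^ (suc d) * cG a (suc d) (suc d) → Symmetric a (suc d)
  cG-symmetric-suc a d sym-d endpoint i j i+j≡1+d =
    x∙y⁻¹≈ε⇒x≈y _ _ (trans (antidiagonal-invariant a d sym-d i j i+j≡1+d) (x≈y⇒x∙y⁻¹≈ε endpoint))

  endpoint-evenIndex : ∀ a d → Symmetric a d → minusOne^ (suc d) ≡ 1ℚ →
    cG a 0 (suc d) ≡ minusOne^ (suc d) * cG a (suc d) (suc d)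
  endpoint-evenIndex a d sym-d even = begin
    c₀                     ≡⟨ x∙y⁻¹≈ε⇒x≈y c₀ cₙ difference≡0 ⟩
    cₙ                     ≡⟨ *-identityˡ cₙ ⟨
    1ℚ * cₙ                ≡⟨ cong (_* cₙ) even ⟨
    minusOne^ (suc d) * cₙ ∎
    where
    open ≡-Reasoning
    c₀ = cG a 0 (suc d)
    cₙ = cG a (suc d) (suc d)
    swapped : cₙ - 1ℚ * c₀ ≡ c₀ - 1ℚ * cₙ
    swapped = subst (λ s → cₙ - s * c₀ ≡ c₀ - s * cₙ) even
                    (antidiagonal-invariant a d sym-d (suc d) 0 (ℕP.+-identityʳ _))
    difference≡0 : c₀ - cₙ ≡ 0ℚ
    difference≡0 = begin
      c₀ - cₙ                                    ≡⟨ solve 2 (λ x y → x :- y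
                                                                   := con ½ :* ((x :- con 1ℚ :* y) :- (y :- con 1ℚ :* x)))
                                                             refl c₀ cₙ ⟩
      ½ * ((c₀ - 1ℚ * cₙ) - (cₙ - 1ℚ * c₀))      ≡⟨ cong (λ z → ½ * ((c₀ - 1ℚ * cₙ) - z)) swapped ⟩
      ½ * ((c₀ - 1ℚ * cₙ) - (c₀ - 1ℚ * cₙ))      ≡⟨ cong (½ *_) (+-inverseʳ (c₀ - 1ℚ * cₙ)) ⟩
      0ℚ                                         ∎

  endpoint-oddIndex : ∀ a p → Symmetric a (2 ℕ.+ p) → minusOne^ (2 ℕ.+ p) ≡ 1ℚ →
    cG a 0 (3 ℕ.+ p) ≡ minusOne^ (3 ℕ.+ p) * cG a (3 ℕ.+ p) (3 ℕ.+ p)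
  endpoint-oddIndex a p sym-q even = begin
    cG a 0 n                               ≡⟨ solve 2 (λ x f → f := con (- 1ℚ) :* x :+ (x :+ f)) refl (b a n) (cG a 0 n) ⟩
    - 1ℚ * b a n + (b a n + cG a 0 n)      ≡⟨ cong (- 1ℚ * b a n +_) (cG-recurrence a p) ⟩
    - 1ℚ * b a n + ½ * (b a q - cG a 0 q)  ≡⟨ cong (λ z → - 1ℚ * b a n + ½ * (b a q - z)) (cG-zero≡b a sym-q even) ⟩
    - 1ℚ * b a n + ½ * (b a q - b a q)     ≡⟨ solve 2 (λ x y → con (- 1ℚ) :* x :+ con ½ :* (y :- y) := con (- 1ℚ) :* x)
                                                      refl (b a n) (b a q) ⟩
    - 1ℚ * b a n                           ≡⟨ cong₂ _*_ (cong -_ even) (cG-diagonal a n) ⟨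
    minusOne^ n * cG a n n                 ∎
    where
    open ≡-Reasoning
    q = 2 ℕ.+ p
    n = 3 ℕ.+ p

  cG-endpoint : ∀ a d → Symmetric a d → minusOne^ d ≡ 1ℚ ⊎ minusOne^ d ≡ - 1ℚ →
    cG a 0 (suc d) ≡ minusOne^ (suc d) * cG a (suc d) (suc d)
  cG-endpoint a d sym-d (inj₂ odd) = endpoint-evenIndex a d sym-d (cong -_ odd)
  cG-endpoint a zero sym-d (inj₁ _) = refl -- c(0,1) = ½ = - c(1,1) by evaluation
  cG-endpoint a (suc zero) sym-d (inj₁ ())
  cG-endpoint a (suc (suc p)) sym-d (inj₁ even) = endpoint-oddIndex a p sym-d even

  cG-symmetric : ∀ a d → Symmetric a d
  cG-symmetric a zero = cG-symmetric-zero a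
  cG-symmetric a (suc d) = cG-symmetric-suc a d sym-d (cG-endpoint a d sym-d (minusOne^-cases d))
    where
    sym-d = cG-symmetric a d

  half-of-double : ∀ {x y} → x + x ≡ y → x ≡ ½ * y
  half-of-double {x} x+x≡y = trans (solve 1 (λ x → x := con ½ :* (x :+ x)) refl x) (cong (½ *_) x+x≡y)

  cG-middle-oddRow : ∀ a h → cG a h (suc (h ℕ.+ h)) ≡ ½ * cG a h (h ℕ.+ h)
  cG-middle-oddRow a h = half-of-double (begin
    c + c                    ≡⟨ cong (c +_) (cG-symmetric a (suc (h ℕ.+ h)) h (suc h) (ℕP.+-suc h h)) ⟩
    c + minusOne^ (suc (h ℕ.+ h)) * cG a (suc h) (suc (h ℕ.+ h))
                             ≡⟨ cong₂ (λ s z → c + s * z) (cong -_ (minusOne^-double h))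
                                                          (cG-suc-index a (ℕP.m≤m+n h h)) ⟩
    c + - 1ℚ * (c - m)       ≡⟨ solve 2 (λ c m → c :+ con (- 1ℚ) :* (c :- m) := m) refl c m ⟩
    m                        ∎)
    where
    open ≡-Reasoning
    c = cG a h (suc (h ℕ.+ h))
    m = cG a h (h ℕ.+ h)

  -- false for h = 0 unless a = -1: c(0,2) = a/4, while -½ c(0,1) = -¼
  cG-zero-evenRow : ∀ a h → 0 ℕ.< h → cG a 0 (suc (suc (h ℕ.+ h))) ≡ ½ * - cG a 0 (suc (h ℕ.+ h))
  cG-zero-evenRow a (suc k) _ = half-of-double (begin
    x + x            ≡⟨ cong (_+ x) (cG-zero≡b a (cG-symmetric a n) (trans (⁻¹-involutive _) (minusOne^-double h))) ⟩
    b a n + x        ≡⟨ cG-recurrence a (k ℕ.+ suc k) ⟩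
    ½ * (b a q - z)  ≡⟨ cong (λ y → ½ * (y - z)) (b≡-cG-zero a (cG-symmetric a q) (cong -_ (minusOne^-double h))) ⟩
    ½ * (- z - z)    ≡⟨ solve 1 (λ z → con ½ :* (:- z :- z) := :- z) refl z ⟩
    - z              ∎)
    where
    open ≡-Reasoning
    h = suc k
    q = suc (h ℕ.+ h)
    n = suc q
    x = cG a 0 n
    z = cG a 0 q

  p≤p-q : ∀ {p q} → q ≤ 0ℚ → p ≤ p - q
  p≤p-q {p} q≤0 = subst (_≤ p - _) (+-identityʳ p) (+-monoʳ-≤ p (neg-antimono-≤ q≤0))

  p-q≤p : ∀ {p q} → 0ℚ ≤ q → p - q ≤ p
  p-q≤p {p} 0≤q = subst (p - _ ≤_) (+-identityʳ p) (+-monoʳ-≤ p (neg-antimono-≤ 0≤q))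

  stepwise⇒related : ∀ {ℓ₁ ℓ₂} {A : Set ℓ₁} (_∼_ : Rel A ℓ₂) → Reflexive _∼_ → Transitive _∼_ →
    ∀ {f : ℕ → A} {h} → (∀ j → j ℕ.< h → f j ∼ f (suc j)) → ∀ {i j} → i ℕ.≤ j → j ℕ.≤ h → f i ∼ f j
  stepwise⇒related _∼_ refl′ trans′ steps {j = zero} z≤n _ = refl′
  stepwise⇒related _∼_ refl′ trans′ {f} steps {i} {suc j} i≤1+j 1+j≤h with ℕP.m≤n⇒m<n∨m≡n i≤1+j
  ... | inj₁ i<1+j =
    trans′ (stepwise⇒related _∼_ refl′ trans′ steps (ℕP.≤-pred i<1+j) (ℕP.<⇒≤ 1+j≤h)) (steps j 1+j≤h)
  ... | inj₂ refl = refl′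

  row : ℤ → ℕ → ℕ → ℚ
  row a d j = cG a j d

  Increasing Decreasing NonNegativeUpTo NonPositiveUpTo : (ℕ → ℚ) → ℕ → Set
  Increasing f h = ∀ j → j ℕ.< h → f j ≤ f (suc j)
  Decreasing f h = ∀ j → j ℕ.< h → f j ≥ f (suc j)
  NonNegativeUpTo f h = ∀ j → j ℕ.≤ h → 0ℚ ≤ f j
  NonPositiveUpTo f h = ∀ j → j ℕ.≤ h → f j ≤ 0ℚ

  IncreasingFromNonNeg DecreasingToNonNeg DecreasingFromNonPos IncreasingToNonPos : ℤ → ℕ → ℕ → Set
  IncreasingFromNonNeg a d h = (0ℚ ≤ cG a 0 d) × Increasing (row a d) h
  DecreasingToNonNeg a d h = (0ℚ ≤ cG a h d) × Decreasing (row a d) h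
  DecreasingFromNonPos a d h = (cG a 0 d ≤ 0ℚ) × Decreasing (row a d) h
  IncreasingToNonPos a d h = (cG a h d ≤ 0ℚ) × Increasing (row a d) h

  nonPositive⇒increasing-next : ∀ a {d h} → h ℕ.≤ d →
    NonPositiveUpTo (row a d) h → Increasing (row a (suc d)) (suc h)
  nonPositive⇒increasing-next a h≤d nonPos j j<1+h =
    subst (cG a j _ ≤_) (sym (cG-suc-index a (ℕP.≤-trans j≤h h≤d))) (p≤p-q (nonPos j j≤h))
    where j≤h = ℕP.≤-pred j<1+h

  nonNegative⇒decreasing-next : ∀ a {d h} → h ℕ.≤ d →
    NonNegativeUpTo (row a d) h → Decreasing (row a (suc d)) (suc h)
  nonNegative⇒decreasing-next a h≤d nonNeg j j<1+h =
    subst (_≤ cG a j _) (sym (cG-suc-index a (ℕP.≤-trans j≤h h≤d))) (p-q≤p (nonNeg j j≤h))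
    where j≤h = ℕP.≤-pred j<1+h

  increasingFromNonNeg⇒decreasingToNonNeg : ∀ a {h d} → h ℕ.+ h ≡ d →
    IncreasingFromNonNeg a d h → DecreasingToNonNeg a (suc d) h
  increasingFromNonNeg⇒decreasingToNonNeg a {h} refl (0≤c₀ , increasing) =
    subst (0ℚ ≤_) (sym (cG-middle-oddRow a h)) (*-monoˡ-≤-nonNeg ½ (upToNonNeg h ℕP.≤-refl)) ,
    λ j j<h → nonNegative⇒decreasing-next a (ℕP.m≤m+n h h) upToNonNeg j (ℕP.m<n⇒m<1+n j<h)
    where
    upToNonNeg : NonNegativeUpTo (row a (h ℕ.+ h)) h
    upToNonNeg j j≤h = ≤-trans 0≤c₀ (stepwise⇒related _≤_ ≤-refl ≤-trans increasing z≤n j≤h)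

  decreasingFromNonPos⇒increasingToNonPos : ∀ a {h d} → h ℕ.+ h ≡ d →
    DecreasingFromNonPos a d h → IncreasingToNonPos a (suc d) h
  decreasingFromNonPos⇒increasingToNonPos a {h} refl (c₀≤0 , decreasing) =
    subst (_≤ 0ℚ) (sym (cG-middle-oddRow a h)) (*-monoˡ-≤-nonNeg ½ (upToNonPos h ℕP.≤-refl)) ,
    λ j j<h → nonPositive⇒increasing-next a (ℕP.m≤m+n h h) upToNonPos j (ℕP.m<n⇒m<1+n j<h)
    where
    upToNonPos : NonPositiveUpTo (row a (h ℕ.+ h)) h
    upToNonPos j j≤h = ≤-trans (stepwise⇒related _≥_ ≤-refl (flip ≤-trans) decreasing z≤n j≤h) c₀≤0

  increasingToNonPos⇒increasingFromNonNeg : ∀ a {h d} → 0 ℕ.< h → suc (h ℕ.+ h) ≡ d →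
    IncreasingToNonPos a d h → IncreasingFromNonNeg a (suc d) (suc h)
  increasingToNonPos⇒increasingFromNonNeg a {h} 0<h refl (cₕ≤0 , increasing) =
    subst (0ℚ ≤_) (sym (cG-zero-evenRow a h 0<h)) (*-monoˡ-≤-nonNeg ½ (neg-antimono-≤ (upToNonPos 0 z≤n))) ,
    nonPositive⇒increasing-next a (ℕP.m≤n⇒m≤1+n (ℕP.m≤m+n h h)) upToNonPos
    where
    upToNonPos : NonPositiveUpTo (row a (suc (h ℕ.+ h))) h
    upToNonPos j j≤h = ≤-trans (stepwise⇒related _≤_ ≤-refl ≤-trans increasing j≤h ℕP.≤-refl) cₕ≤0

  decreasingToNonNeg⇒decreasingFromNonPos : ∀ a {h d} → 0 ℕ.< h → suc (h ℕ.+ h) ≡ d →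
    DecreasingToNonNeg a d h → DecreasingFromNonPos a (suc d) (suc h)
  decreasingToNonNeg⇒decreasingFromNonPos a {h} 0<h refl (0≤cₕ , decreasing) =
    subst (_≤ 0ℚ) (sym (cG-zero-evenRow a h 0<h)) (*-monoˡ-≤-nonNeg ½ (neg-antimono-≤ (upToNonNeg 0 z≤n))) ,
    nonNegative⇒decreasing-next a (ℕP.m≤n⇒m≤1+n (ℕP.m≤m+n h h)) upToNonNeg
    where
    upToNonNeg : NonNegativeUpTo (row a (suc (h ℕ.+ h))) h
    upToNonNeg j j≤h = ≤-trans 0≤cₕ (stepwise⇒related _≥_ ≤-refl (flip ≤-trans) decreasing j≤h ℕP.≤-refl)

  a/1≤0 : ∀ {a} → a ℤ.≤ -[1+ 0 ] → a / 1 ≤ 0ℚ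
  a/1≤0 {ℤ.+ _} ()
  a/1≤0 { -[1+ n ]} _ = neg-antimono-≤ (nonNegative⁻¹ (normalize (suc n) 1) {{normalize-nonNeg (suc n) 1}})

  row[2] : ∀ {a} → a ℤ.≤ -[1+ 0 ] → DecreasingFromNonPos a 2 1
  row[2] {a} a≤-1 = c₀≤0 , decreasing
    where
    c₀≤0 : cG a 0 2 ≤ 0ℚ
    c₀≤0 = subst (_≤ 0ℚ) (sym (cG-zero≡b a (cG-symmetric a 2) refl))
                 (*-monoˡ-≤-nonNeg (half^ 2) (a/1≤0 a≤-1))
    0≤c₀₁ : 0ℚ ≤ cG a 0 1
    0≤c₀₁ = *≤* (ℤ.+≤+ z≤n) -- cG a 0 1 evaluates to ½
    decreasing : Decreasing (row a 2) 1
    decreasing zero _ = subst (_≤ cG a 0 2) (sym (cG-suc-index a {1} z≤n)) (p-q≤p 0≤c₀₁)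
    decreasing (suc j) (s≤s ())

open import Data.Nat as ℕ using (ℕ; suc; _*_; _+_; _<_)
open import Data.Integer as ℤ using (ℤ; -[1+_])
open import Data.Rational using (ℚ; 0ℚ; _≤_)
open import Data.Product using (_×_)
open import Data.Product using (_,_; proj₂)
open import Data.Nat.Properties using (m≤n+m)
open import Data.Nat.Tactic.RingSolver using (solve-∀)
open import Relation.Binary.PropositionalEquality using (_≡_; refl; subst₂)

row[4m+3]⇒row[4m+4] : ∀ a m →
  IncreasingToNonPos a (4 * m + 3) (2 * m + 1) → IncreasingFromNonNeg a (4 * suc m) (2 * suc m)
row[4m+3]⇒row[4m+4] a m r = subst₂ (IncreasingFromNonNeg a) (rowIndex m) (halfIndex m)
  (increasingToNonPos⇒increasingFromNonNeg a (m≤n+m 1 (2 * m)) (shape m) r)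
  where
  shape : ∀ m → suc ((2 * m + 1) + (2 * m + 1)) ≡ 4 * m + 3
  shape = solve-∀
  rowIndex : ∀ m → suc (4 * m + 3) ≡ 4 * suc m
  rowIndex = solve-∀
  halfIndex : ∀ m → suc (2 * m + 1) ≡ 2 * suc m
  halfIndex = solve-∀

row[4m]⇒row[4m+1] : ∀ a m →
  IncreasingFromNonNeg a (4 * m) (2 * m) → DecreasingToNonNeg a (4 * m + 1) (2 * m)
row[4m]⇒row[4m+1] a m r = subst₂ (DecreasingToNonNeg a) (rowIndex m) refl
  (increasingFromNonNeg⇒decreasingToNonNeg a (shape m) r)
  where
  shape : ∀ m → 2 * m + 2 * m ≡ 4 * m
  shape = solve-∀
  rowIndex : ∀ m → suc (4 * m) ≡ 4 * m + 1
  rowIndex = solve-∀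

row[4m+1]⇒row[4m+2] : ∀ a m →
  DecreasingToNonNeg a (4 * suc m + 1) (2 * suc m) → DecreasingFromNonPos a (4 * suc m + 2) (2 * suc m + 1)
row[4m+1]⇒row[4m+2] a m r = subst₂ (DecreasingFromNonPos a) (rowIndex m) (halfIndex m)
  (decreasingToNonNeg⇒decreasingFromNonPos a ℕ.z<s (shape m) r)
  where
  shape : ∀ m → suc (2 * suc m + 2 * suc m) ≡ 4 * suc m + 1
  shape = solve-∀
  rowIndex : ∀ m → suc (4 * suc m + 1) ≡ 4 * suc m + 2
  rowIndex = solve-∀
  halfIndex : ∀ m → suc (2 * suc m) ≡ 2 * suc m + 1
  halfIndex = solve-∀

row[4m+2]⇒row[4m+3] : ∀ a m →
  DecreasingFromNonPos a (4 * m + 2) (2 * m + 1) → IncreasingToNonPos a (4 * m + 3) (2 * m + 1)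
row[4m+2]⇒row[4m+3] a m r = subst₂ (IncreasingToNonPos a) (rowIndex m) refl
  (decreasingFromNonPos⇒increasingToNonPos a (shape m) r)
  where
  shape : ∀ m → (2 * m + 1) + (2 * m + 1) ≡ 4 * m + 2
  shape = solve-∀
  rowIndex : ∀ m → suc (4 * m + 2) ≡ 4 * m + 3
  rowIndex = solve-∀

SignPattern : ℤ → ℕ → Set
SignPattern a m = IncreasingFromNonNeg a (4 * m) (2 * m) × DecreasingToNonNeg a (4 * m + 1) (2 * m)
                × DecreasingFromNonPos a (4 * m + 2) (2 * m + 1) × IncreasingToNonPos a (4 * m + 3) (2 * m + 1)

signPattern-suc : ∀ a m → IncreasingToNonPos a (4 * m + 3) (2 * m + 1) → SignPattern a (suc m)
signPattern-suc a m r₃ = r₀ , r₁ , r₂ , row[4m+2]⇒row[4m+3] a (suc m) r₂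
  where
  r₀ = row[4m+3]⇒row[4m+4] a m r₃
  r₁ = row[4m]⇒row[4m+1] a (suc m) r₀
  r₂ = row[4m+1]⇒row[4m+2] a m r₁

row[4m+3] : ∀ a → a ℤ.≤ -[1+ 0 ] → ∀ m → IncreasingToNonPos a (4 * m + 3) (2 * m + 1)
row[4m+3] a a≤-1 ℕ.zero = row[4m+2]⇒row[4m+3] a 0 (row[2] a≤-1)
row[4m+3] a a≤-1 (suc m) = proj₂ (proj₂ (proj₂ (signPattern-suc a m (row[4m+3] a a≤-1 m))))

mainTheorem14 : (a : ℤ) → a ℤ.≤ -[1+ 0 ] → (m : ℕ) → 1 ℕ.≤ m →
  ((0ℚ ≤ cG a 0 (4 * m)) × (∀ j → j < 2 * m → cG a j (4 * m) ≤ cG a (suc j) (4 * m)))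
  × ((0ℚ ≤ cG a (2 * m) (4 * m + 1)) × (∀ j → j < 2 * m → cG a (suc j) (4 * m + 1) ≤ cG a j (4 * m + 1)))
  × ((cG a 0 (4 * m + 2) ≤ 0ℚ) × (∀ j → j < 2 * m + 1 → cG a (suc j) (4 * m + 2) ≤ cG a j (4 * m + 2)))
  × ((cG a (2 * m + 1) (4 * m + 3) ≤ 0ℚ) × (∀ j → j < 2 * m + 1 → cG a j (4 * m + 3) ≤ cG a (suc j) (4 * m + 3)))
mainTheorem14 a a≤-1 (suc m) _ = signPattern-suc a m (row[4m+3] a a≤-1 m)
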